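{- Let $h,k$ be integers with $1\le h<k$ and $\gcd(h,k)=1$, and let $R>0$ with $k\ge2R^2$. Suppose $Z_R(h,k)$ is non-empty and let $(\beta_1,\gamma_1)\in Z_R(h,k)$ be a pair with $|\beta_1\gamma_1|$ minimal. Then for every $(\beta,\gamma)\in Z_R(h,k)$ there is a positive integer $\lambda$ with $(\beta,\gamma)=(\lambda\beta_1,\lambda\gamma_1)$.
   Context: $Z_R(h,k):=\{(\beta,\gamma)\in\mathbb Z^2:\ 1\le|\beta|<R,\ 1\le\gamma<R,\ \beta h\equiv\gamma\bmod k\}$.
   Formalization: The parameter R ranges over the positive rationals. -}

module Defs where

open import Data.Nat using (ℕ)
open import Data.Integer as ℤ using (ℤ; +_; _-_; ∣_∣)
open import Data.Integer.Divisibility using (_∣_)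
open import Data.Rational as ℚ using (ℚ; _/_)
open import Data.Product using (_×_)

toℚ : ℤ → ℚ
toℚ x = x / 1

InZ : ℚ → ℤ → ℤ → ℤ → ℤ → Set
InZ R h k β γ =
  (ℤ.1ℤ ℤ.≤ + ∣ β ∣) × (toℚ (+ ∣ β ∣) ℚ.< R)
  × (ℤ.1ℤ ℤ.≤ γ) × (toℚ γ ℚ.< R)
  × (k ∣ (β ℤ.* h - γ))

{-# OPTIONS --safe #-}
module Submission where

open import Defs
open import Data.Nat as ℕ using (ℕ)
open import Data.Integer as ℤ using (ℤ; +_; ∣_∣; _+_; _-_; _*_)
open import Data.Integer.GCD using (gcd)
open import Data.Rational as ℚ using (ℚ)
open import Data.Product using (_×_; ∃; _,_; uncurry)
open import Data.Empty using (⊥; ⊥-elim)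
open import Relation.Binary.PropositionalEquality
open import Relation.Nullary using (contradiction)
import Data.Nat.Coprimality as Coprime
import Data.Nat.Divisibility as ℕ
import Data.Nat.Properties as ℕ
import Data.Integer.Properties as ℤ
import Data.Integer.DivMod as ℤ
open import Data.Integer.Divisibility using (_∣_)
import Data.Integer.Divisibility.Signed as Signed
open import Data.Integer.Tactic.RingSolver using (solve-∀)
import Data.Rational.Properties as ℚ

-- For two pairs (β, γ), (β₁, γ₁) of Z_R(h,k) the congruences give βγ₁ ≡ β₁γ (mod k), while
-- |βγ₁ - β₁γ| < 2R² ≤ k; hence βγ₁ = β₁γ. Write γ = qγ₁ + r with 0 ≤ r < γ₁. The pair
-- (β - qβ₁, r) still satisfies the congruence, and |β - qβ₁| γ₁ = |β₁| r. So if r ≠ 0 it lies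
-- in Z_R(h,k) with |β - qβ₁| < |β₁|, and its product is smaller than |β₁γ₁|, contradicting
-- minimality. Therefore r = 0, γ = qγ₁ and then β = qβ₁.

-- x / 1 normalises through gcd, which does not compute on a variable x;
-- the literal fraction with denominator 1 does.
fromℤ : ℤ → ℚ
fromℤ x = ℚ.mkℚ x 0 (Coprime.sym (Coprime.1-coprimeTo ∣ x ∣))

toℚ≡fromℤ : ∀ x → toℚ x ≡ fromℤ x
toℚ≡fromℤ x = ℚ.↥p/↧p≡p (fromℤ x)

toℚ-homo-* : ∀ x y → toℚ (x * y) ≡ toℚ x ℚ.* toℚ y
toℚ-homo-* x y rewrite toℚ≡fromℤ x | toℚ≡fromℤ y = refl

toℚ-homo-+ : ∀ x y → toℚ (x + y) ≡ toℚ x ℚ.+ toℚ y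
toℚ-homo-+ x y
  rewrite toℚ≡fromℤ x | toℚ≡fromℤ y | ℤ.*-identityʳ x | ℤ.*-identityʳ y = refl

toℚ-mono-≤ : ∀ {x y} → x ℤ.≤ y → toℚ x ℚ.≤ toℚ y
toℚ-mono-≤ {x} {y} x≤y rewrite toℚ≡fromℤ x | toℚ≡fromℤ y =
  ℚ.*≤* (subst₂ ℤ._≤_ (sym (ℤ.*-identityʳ x)) (sym (ℤ.*-identityʳ y)) x≤y)

toℚ-mono-< : ∀ {x y} → x ℤ.< y → toℚ x ℚ.< toℚ y
toℚ-mono-< {x} {y} x<y rewrite toℚ≡fromℤ x | toℚ≡fromℤ y =
  ℚ.*<* (subst₂ ℤ._<_ (sym (ℤ.*-identityʳ x)) (sym (ℤ.*-identityʳ y)) x<y)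

toℚ-cancel-< : ∀ {x y} → toℚ x ℚ.< toℚ y → x ℤ.< y
toℚ-cancel-< {x} {y} p<q rewrite toℚ≡fromℤ x | toℚ≡fromℤ y with p<q
... | ℚ.*<* x*1<y*1 = subst₂ ℤ._<_ (ℤ.*-identityʳ x) (ℤ.*-identityʳ y) x*1<y*1

module _ {R : ℚ} where
  open ℚ.≤-Reasoning

  product-<-square : ∀ a b → toℚ (+ a) ℚ.< R → toℚ (+ b) ℚ.< R →
    toℚ (+ (a ℕ.* b)) ℚ.< R ℚ.* R
  product-<-square a b a<R b<R = begin-strict
    toℚ (+ (a ℕ.* b))        ≡⟨ cong toℚ (ℤ.pos-* a b) ⟩
    toℚ (+ a * + b)          ≡⟨ toℚ-homo-* (+ a) (+ b) ⟩
    toℚ (+ a) ℚ.* toℚ (+ b)  ≤⟨ ℚ.*-monoˡ-≤-nonNeg (toℚ (+ a)) {{ℚ.nonNegative (0≤ a)}}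
                                  (ℚ.<⇒≤ b<R) ⟩
    toℚ (+ a) ℚ.* R          <⟨ ℚ.*-monoˡ-<-pos R {{ℚ.positive (ℚ.≤-<-trans (0≤ b) b<R)}} a<R ⟩
    R ℚ.* R                  ∎
    where
    0≤ : ∀ n → ℚ.0ℚ ℚ.≤ toℚ (+ n)
    0≤ n = toℚ-mono-≤ {+ 0} {+ n} (ℤ.+≤+ ℕ.z≤n)

  sum-of-two-products-< : ∀ {k} a b c d → toℚ (+ 2) ℚ.* R ℚ.* R ℚ.≤ toℚ k →
    toℚ (+ a) ℚ.< R → toℚ (+ b) ℚ.< R → toℚ (+ c) ℚ.< R → toℚ (+ d) ℚ.< R →
    a ℕ.* b ℕ.+ c ℕ.* d ℕ.< ∣ k ∣
  sum-of-two-products-< {k} a b c d 2R²≤k a<R b<R c<R d<R =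
    +<⇒<∣∣ (toℚ-cancel-< {+ (a ℕ.* b ℕ.+ c ℕ.* d)} {k} (begin-strict
      toℚ (+ (a ℕ.* b ℕ.+ c ℕ.* d))              ≡⟨ cong toℚ (ℤ.pos-+ (a ℕ.* b) (c ℕ.* d)) ⟩
      toℚ (+ (a ℕ.* b) + + (c ℕ.* d))            ≡⟨ toℚ-homo-+ (+ (a ℕ.* b)) (+ (c ℕ.* d)) ⟩
      toℚ (+ (a ℕ.* b)) ℚ.+ toℚ (+ (c ℕ.* d))    <⟨ ℚ.+-mono-< (product-<-square a b a<R b<R)
                                                                 (product-<-square c d c<R d<R) ⟩
      R² ℚ.+ R²                                  ≡⟨ cong₂ ℚ._+_ (ℚ.*-identityˡ R²)
                                                                (ℚ.*-identityˡ R²) ⟨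
      ℚ.1ℚ ℚ.* R² ℚ.+ ℚ.1ℚ ℚ.* R²                ≡⟨ ℚ.*-distribʳ-+ R² ℚ.1ℚ ℚ.1ℚ ⟨
      (ℚ.1ℚ ℚ.+ ℚ.1ℚ) ℚ.* R²                     ≡⟨ ℚ.*-assoc (toℚ (+ 2)) R R ⟨
      toℚ (+ 2) ℚ.* R ℚ.* R                      ≤⟨ 2R²≤k ⟩
      toℚ k                                      ∎))
    where
    R² : ℚ
    R² = R ℚ.* R
    +<⇒<∣∣ : ∀ {n i} → + n ℤ.< i → n ℕ.< ∣ i ∣
    +<⇒<∣∣ (ℤ.+<+ n<m) = n<m

∣-linear-combination : ∀ {k} a x b y → k ∣ x → k ∣ y → k ∣ a * x - b * y
∣-linear-combination {k} a x b y k∣x k∣y = Signed.∣⇒∣ᵤ {k} (Signed.∣m∣n⇒∣m-n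
  (Signed.∣n⇒∣m*n a (Signed.∣ᵤ⇒∣ {k} k∣x)) (Signed.∣n⇒∣m*n b (Signed.∣ᵤ⇒∣ {k} k∣y)))

∣∧∣i∣<∣k∣⇒i≡0 : ∀ {k i} → k ∣ i → ∣ i ∣ ℕ.< ∣ k ∣ → i ≡ + 0
∣∧∣i∣<∣k∣⇒i≡0 {k} {i} k∣i ∣i∣<∣k∣ with ∣ i ∣ in ∣i∣≡
... | 0       = ℤ.∣i∣≡0⇒i≡0 ∣i∣≡
... | ℕ.suc _ = contradiction k∣i (ℕ.>⇒∤ ∣i∣<∣k∣)

cross-∣ : ∀ h k β γ β₁ γ₁ → k ∣ β * h - γ → k ∣ β₁ * h - γ₁ → k ∣ β * γ₁ - β₁ * γ
cross-∣ h k β γ β₁ γ₁ k∣βh-γ k∣β₁h-γ₁ = subst (k ∣_) (identity β γ β₁ γ₁ h)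
  (∣-linear-combination {k} β₁ (β * h - γ) β (β₁ * h - γ₁) k∣βh-γ k∣β₁h-γ₁)
  where
  identity : ∀ β γ β₁ γ₁ h → β₁ * (β * h - γ) - β * (β₁ * h - γ₁) ≡ β * γ₁ - β₁ * γ
  identity = solve-∀

sub-multiple-∣ : ∀ h k β γ β₁ γ₁ q γ′ → γ ≡ γ′ + q * γ₁ →
  k ∣ β * h - γ → k ∣ β₁ * h - γ₁ → k ∣ (β - q * β₁) * h - γ′
sub-multiple-∣ h k β γ β₁ γ₁ q γ′ refl k∣βh-γ k∣β₁h-γ₁ = subst (k ∣_) (identity β β₁ γ₁ q γ′ h)
  (∣-linear-combination {k} (+ 1) (β * h - γ) q (β₁ * h - γ₁) k∣βh-γ k∣β₁h-γ₁)
  where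
  identity : ∀ β β₁ γ₁ q γ′ h →
    + 1 * (β * h - (γ′ + q * γ₁)) - q * (β₁ * h - γ₁) ≡ (β - q * β₁) * h - γ′
  identity = solve-∀

sub-multiple-proportional : ∀ β γ β₁ γ₁ q γ′ → γ ≡ γ′ + q * γ₁ →
  β * γ₁ ≡ β₁ * γ → (β - q * β₁) * γ₁ ≡ β₁ * γ′
sub-multiple-proportional β γ β₁ γ₁ q γ′ refl βγ₁≡β₁γ = begin
  (β - q * β₁) * γ₁                    ≡⟨ expand β β₁ γ₁ q ⟩
  β * γ₁ - q * β₁ * γ₁                 ≡⟨ cong (_- q * β₁ * γ₁) βγ₁≡β₁γ ⟩
  β₁ * (γ′ + q * γ₁) - q * β₁ * γ₁     ≡⟨ cancel β₁ γ₁ q γ′ ⟩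
  β₁ * γ′                              ∎
  where
  open ≡-Reasoning
  expand : ∀ β β₁ γ₁ q → (β - q * β₁) * γ₁ ≡ β * γ₁ - q * β₁ * γ₁
  expand = solve-∀
  cancel : ∀ β₁ γ₁ q γ′ → β₁ * (γ′ + q * γ₁) - q * β₁ * γ₁ ≡ β₁ * γ′
  cancel = solve-∀

proportional⇒multiple : ∀ β γ β₁ γ₁ q .{{_ : ℤ.NonZero γ₁}} →
  γ ≡ q * γ₁ → β * γ₁ ≡ β₁ * γ → β ≡ q * β₁
proportional⇒multiple β γ β₁ γ₁ q refl βγ₁≡β₁γ = ℤ.*-cancelʳ-≡ β (q * β₁) γ₁ (begin
  β * γ₁          ≡⟨ βγ₁≡β₁γ ⟩
  β₁ * (q * γ₁)   ≡⟨ reassociate β₁ q γ₁ ⟩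
  q * β₁ * γ₁     ∎)
  where
  open ≡-Reasoning
  reassociate : ∀ β₁ q γ₁ → β₁ * (q * γ₁) ≡ q * β₁ * γ₁
  reassociate = solve-∀

quotient-pos : ∀ {c q c₁} → + c ≡ q * + c₁ → 0 ℕ.< c → ℤ.1ℤ ℤ.≤ q
quotient-pos {c} {q} {c₁} c≡qc₁ 0<c = ℤ.i<j⇒suc[i]≤j
  (ℤ.*-cancelʳ-<-nonNeg {ℤ.0ℤ} {q} (+ c₁) (subst (ℤ.0ℤ ℤ.<_) c≡qc₁ (ℤ.+<+ 0<c)))

proportional-< : ∀ {a b r c} → a ℕ.* c ≡ b ℕ.* r → r ℕ.< c → 0 ℕ.< b → a ℕ.< b
proportional-< {a} {b} {r} {c} ac≡br r<c 0<b = ℕ.*-cancelʳ-< c a b (begin-strict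
  a ℕ.* c  ≡⟨ ac≡br ⟩
  b ℕ.* r  <⟨ ℕ.*-monoʳ-< b {{ℕ.>-nonZero 0<b}} r<c ⟩
  b ℕ.* c  ∎)
  where open ℕ.≤-Reasoning

proportional-pos : ∀ {a b r c} → a ℕ.* c ≡ b ℕ.* r → 0 ℕ.< b → 0 ℕ.< r → 0 ℕ.< a
proportional-pos {ℕ.zero}  () (ℕ.s≤s _) (ℕ.s≤s _)
proportional-pos {ℕ.suc _} _  _         _         = ℕ.z<s

module _ (R : ℚ) (h k : ℤ) where

  InZ-proportional : toℚ (+ 2) ℚ.* R ℚ.* R ℚ.≤ toℚ k → ∀ β₁ c₁ β c →
    InZ R h k β₁ (+ c₁) → InZ R h k β (+ c) → β * + c₁ ≡ β₁ * + c
  InZ-proportional 2R²≤k β₁ c₁ β c (_ , β₁<R , _ , c₁<R , k∣β₁h-c₁) (_ , β<R , _ , c<R , k∣βh-c) =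
    ℤ.i-j≡0⇒i≡j _ _ (∣∧∣i∣<∣k∣⇒i≡0 {k} (cross-∣ h k β (+ c) β₁ (+ c₁) k∣βh-c k∣β₁h-c₁) (begin-strict
      ∣ β * + c₁ - β₁ * + c ∣          ≤⟨ ℤ.∣i-j∣≤∣i∣+∣j∣ (β * + c₁) (β₁ * + c) ⟩
      ∣ β * + c₁ ∣ ℕ.+ ∣ β₁ * + c ∣    ≡⟨ cong₂ ℕ._+_ (ℤ.abs-* β (+ c₁)) (ℤ.abs-* β₁ (+ c)) ⟩
      ∣ β ∣ ℕ.* c₁ ℕ.+ ∣ β₁ ∣ ℕ.* c    <⟨ sum-of-two-products-< {k = k} (∣ β ∣) c₁ (∣ β₁ ∣) c
                                            2R²≤k β<R c₁<R β₁<R c<R ⟩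
      ∣ k ∣                            ∎))
    where open ℕ.≤-Reasoning

  InZ-remainder : ∀ β₁ c₁ β c q r → InZ R h k β₁ (+ c₁) → InZ R h k β (+ c) →
    β * + c₁ ≡ β₁ * + c → + c ≡ + r + q * + c₁ → 0 ℕ.< r → r ℕ.< c₁ →
    InZ R h k (β - q * β₁) (+ r) × ∣ (β - q * β₁) * + r ∣ ℕ.< ∣ β₁ * + c₁ ∣
  InZ-remainder β₁ c₁ β c q r (1≤∣β₁∣ , β₁<R , _ , c₁<R , k∣β₁h-c₁) (_ , _ , _ , _ , k∣βh-c)
                βc₁≡β₁c c≡r+qc₁ 0<r r<c₁ =
    ( ℤ.+≤+ 0<∣β′∣
    , ℚ.<-trans (toℚ-mono-< (ℤ.+<+ ∣β′∣<∣β₁∣)) β₁<R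
    , ℤ.+≤+ 0<r
    , ℚ.<-trans (toℚ-mono-< (ℤ.+<+ r<c₁)) c₁<R
    , sub-multiple-∣ h k β (+ c) β₁ (+ c₁) q (+ r) c≡r+qc₁ k∣βh-c k∣β₁h-c₁ )
    , subst₂ ℕ._<_ (sym (ℤ.abs-* β′ (+ r))) (sym (ℤ.abs-* β₁ (+ c₁)))
        (ℕ.*-mono-< ∣β′∣<∣β₁∣ r<c₁)
    where
    β′ : ℤ
    β′ = β - q * β₁
    ∣β′∣c₁≡∣β₁∣r : ∣ β′ ∣ ℕ.* c₁ ≡ ∣ β₁ ∣ ℕ.* r
    ∣β′∣c₁≡∣β₁∣r = begin
      ∣ β′ ∣ ℕ.* c₁   ≡⟨ ℤ.abs-* β′ (+ c₁) ⟨
      ∣ β′ * + c₁ ∣   ≡⟨ cong ∣_∣ (sub-multiple-proportional β (+ c) β₁ (+ c₁) q (+ r)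
                                     c≡r+qc₁ βc₁≡β₁c) ⟩
      ∣ β₁ * + r ∣    ≡⟨ ℤ.abs-* β₁ (+ r) ⟩
      ∣ β₁ ∣ ℕ.* r    ∎
      where open ≡-Reasoning
    ∣β′∣<∣β₁∣ : ∣ β′ ∣ ℕ.< ∣ β₁ ∣
    ∣β′∣<∣β₁∣ = proportional-< ∣β′∣c₁≡∣β₁∣r r<c₁ (ℤ.drop‿+≤+ 1≤∣β₁∣)
    0<∣β′∣ : 0 ℕ.< ∣ β′ ∣
    0<∣β′∣ = proportional-pos ∣β′∣c₁≡∣β₁∣r (ℤ.drop‿+≤+ 1≤∣β₁∣) 0<r

  multiple-of-minimal : toℚ (+ 2) ℚ.* R ℚ.* R ℚ.≤ toℚ k →
    ∀ β₁ c₁ .{{_ : ℕ.NonZero c₁}} → InZ R h k β₁ (+ c₁) →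
    ((β γ : ℤ) → InZ R h k β γ → ∣ β₁ * + c₁ ∣ ℕ.≤ ∣ β * γ ∣) →
    ∀ β c → InZ R h k β (+ c) →
    ∃ λ (l : ℤ) → (ℤ.1ℤ ℤ.≤ l) × (β ≡ l * β₁) × (+ c ≡ l * + c₁)
  multiple-of-minimal 2R²≤k β₁ c₁ Z₁ minimal β c Z@(_ , _ , 1≤c , _) =
    divide (+ c ℤ./ℕ c₁) (+ c ℤ.%ℕ c₁) (ℤ.a≡a%ℕn+[a/ℕn]*n (+ c) c₁) (ℤ.n%ℕd<d (+ c) c₁)
    where
    βc₁≡β₁c : β * + c₁ ≡ β₁ * + c
    βc₁≡β₁c = InZ-proportional 2R²≤k β₁ c₁ β c Z₁ Z
    divide : ∀ q r → + c ≡ + r + q * + c₁ → r ℕ.< c₁ →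
      ∃ λ (l : ℤ) → (ℤ.1ℤ ℤ.≤ l) × (β ≡ l * β₁) × (+ c ≡ l * + c₁)
    divide q 0 c≡0+qc₁ _ =
      q , quotient-pos c≡qc₁ (ℤ.drop‿+≤+ 1≤c)
        , proportional⇒multiple β (+ c) β₁ (+ c₁) q c≡qc₁ βc₁≡β₁c
        , c≡qc₁
      where
      c≡qc₁ : + c ≡ q * + c₁
      c≡qc₁ = trans c≡0+qc₁ (ℤ.+-identityˡ (q * + c₁))
    divide q (ℕ.suc r) c≡r+qc₁ r<c₁ = ⊥-elim (uncurry minimality-violated
      (InZ-remainder β₁ c₁ β c q (ℕ.suc r) Z₁ Z βc₁≡β₁c c≡r+qc₁ ℕ.z<s r<c₁))
      where
      minimality-violated : InZ R h k (β - q * β₁) (+ ℕ.suc r) →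
        ∣ (β - q * β₁) * + ℕ.suc r ∣ ℕ.< ∣ β₁ * + c₁ ∣ → ⊥
      minimality-violated remainder∈Z smaller =
        ℕ.<⇒≱ smaller (minimal (β - q * β₁) (+ ℕ.suc r) remainder∈Z)

lemma2p9 : (h k : ℤ) (R : ℚ) →
    ℤ.1ℤ ℤ.≤ h → h ℤ.< k → gcd h k ≡ ℤ.1ℤ →
    ℚ.0ℚ ℚ.< R → (toℚ (+ 2) ℚ.* R ℚ.* R) ℚ.≤ toℚ k →
    (β₁ γ₁ : ℤ) → InZ R h k β₁ γ₁ →
    ((β γ : ℤ) → InZ R h k β γ → ∣ β₁ ℤ.* γ₁ ∣ ℕ.≤ ∣ β ℤ.* γ ∣) →
    (β γ : ℤ) → InZ R h k β γ →
    ∃ λ (l : ℤ) → (ℤ.1ℤ ℤ.≤ l) × (β ≡ l ℤ.* β₁) × (γ ≡ l ℤ.* γ₁)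
lemma2p9 _ _ _ _ _ _ _ _ _ ℤ.-[1+ _ ]   (_ , _ , ()       , _) _ _ _ _
lemma2p9 _ _ _ _ _ _ _ _ _ (+ 0)       (_ , _ , ℤ.+≤+ () , _) _ _ _ _
lemma2p9 _ _ _ _ _ _ _ _ _ (+ ℕ.suc _) _ _ _ ℤ.-[1+ _ ] (_ , _ , () , _)
lemma2p9 h k R _ _ _ _ 2R²≤k β₁ (+ ℕ.suc c₁) Z₁ minimal β (+ c) Z =
  multiple-of-minimal R h k 2R²≤k β₁ (ℕ.suc c₁) Z₁ minimal β c Z
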